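{- Let $P=(G,S,X_0,X,Y,Y^*,f)$ be a starred precoloring of a $P_6$-free graph $G$ satisfying axioms (I)–(V), and let $C$ be a component of $G|Y$ such that some vertex $x\in X$ is mixed on $V(C)$. Then $C$ meets exactly two lists $L_1,L_2$ (that is, $\{L_P(v): v\in V(C)\}=\{L_1,L_2\}$ with $L_1\neq L_2$), and $L_P(x)=L_1\cap L_2$.
   Context: A starred precoloring is a $7$-tuple $(G,S,X_0,X,Y,Y^*,f)$ with: (A) $f:S\cup X_0\to\{1,2,3,4\}$ a proper coloring of $G|(S\cup X_0)$; (B) $V(G)=S\cup X_0\cup X\cup Y\cup Y^*$; (C) $G|S$ connected and no vertex of $V(G)\setminus S$ complete to $S$; (D) every vertex of $Y$ has a neighbor in $S$; (E) $|f(N(x)\cap S)|\ge 2$ for every $x\in X$; (F) $Y$ anticomplete to $Y^*$; (G) no vertex of $X$ is mixed on the vertex set of a component of $G|Y^*$; (H) for every component $D$ of $G|Y^*$ some vertex of $S\cup X_0\cup X$ is complete to $V(D)$. A vertex is mixed on a set if it has both a neighbor and a non-neighbor in it. $L_P(v)=\{1,2,3,4\}\setminus f(N(v)\cap S)$; a set $W$ meets a list $L$ if $L_P(w)=L$ for some $w\in W$. A path $a-b-c$ means an induced path. Axioms: (I) every $y\in Y$ satisfies $|L_P(y)|=3$. (II) for distinct $L_1,L_2$ of size three there is no path $a-b-c$ with $a,b,c\in Y$, $L_P(a)=L_1$, $L_P(b)=L_P(c)=L_2$. (III) for pairwise distinct $L_1,L_2,L_3$ of size three there is no path $a-b-c$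 with $a,b,c\in Y$, $L_P(a)=L_1,L_P(b)=L_2,L_P(c)=L_3$. (IV) for $L_1\subseteq\{1,2,3,4\}$ of size three there is no path $a-b-c$ with $a\in X$, $b,c\in Y$ and $L_P(b)=L_P(c)=L_1$. (V) for $L_1,L_2\subseteq\{1,2,3,4\}$ of size three there is no path $a-b-c$ with $L_P(b)=L_1$, $L_P(c)=L_2$, $a\in X$ and $L_P(a)\neq L_1\cap L_2$. $G$ is $P_6$-free if it has no induced six-vertex path. -}

module Defs where

open import Data.Nat using (ℕ; zero; suc; _≥_)
open import Data.Fin using (Fin; toℕ)
open import Data.Fin.Subset using (Subset; ∁; ∣_∣)
open import Data.Bool using (Bool; true; false; _∧_)
open import Data.List using (allFin)
open import Data.Bool.ListAction using (any)
open import Data.Vec using (tabulate)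
open import Data.Product using (Σ; _×_; ∃; ∃-syntax)
open import Data.Sum using (_⊎_)
open import Relation.Nullary using (¬_; does)
open import Relation.Binary.PropositionalEquality using (_≡_; _≢_)
open import Function.Definitions using (Injective)
open import Function.Bundles using (_⇔_)

record Graph (n : ℕ) : Set where
  field
    adj    : Fin n → Fin n → Bool
    sym    : ∀ u v → adj u v ≡ adj v u
    irrefl : ∀ v → adj v v ≡ false
open Graph public

Adj : ∀ {n} → Graph n → Fin n → Fin n → Set
Adj G u v = adj G u v ≡ true

NonAdj : ∀ {n} → Graph n → Fin n → Fin n → Set
NonAdj G u v = adj G u v ≡ false

VSet : ℕ → Set
VSet n = Fin n → Bool

_∈ᵥ_ : ∀ {n} → Fin n → VSet n → Set
v ∈ᵥ W = W v ≡ true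

P6Free : ∀ {n} → Graph n → Set
P6Free {n} G =
  ¬ (Σ (Fin 6 → Fin n) λ p →
      Injective _≡_ _≡_ p ×
      (∀ i j → Adj G (p i) (p j) ⇔ (toℕ i ≡ suc (toℕ j) ⊎ toℕ j ≡ suc (toℕ i))))

data Reach {n} (G : Graph n) (W : VSet n) : Fin n → Fin n → Set where
  here : ∀ {u} → u ∈ᵥ W → Reach G W u u
  step : ∀ {u w v} → u ∈ᵥ W → Adj G u w → Reach G W w v → Reach G W u v

Connected : ∀ {n} → Graph n → VSet n → Set
Connected G W = ∀ u v → u ∈ᵥ W → v ∈ᵥ W → Reach G W u v

IsComponent : ∀ {n} → Graph n → VSet n → VSet n → Set
IsComponent G W C =
  (∀ v → v ∈ᵥ C → v ∈ᵥ W) ×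
  (∃[ v ] v ∈ᵥ C) ×
  Connected G C ×
  (∀ u w → u ∈ᵥ C → w ∈ᵥ W → Adj G u w → w ∈ᵥ C)

Mixed : ∀ {n} → Graph n → Fin n → VSet n → Set
Mixed G v W = (∃[ u ] (u ∈ᵥ W × Adj G v u)) × (∃[ w ] (w ∈ᵥ W × NonAdj G v w))

Complete : ∀ {n} → Graph n → Fin n → VSet n → Set
Complete G v W = ∀ w → w ∈ᵥ W → Adj G v w

Path3 : ∀ {n} → Graph n → Fin n → Fin n → Fin n → Set
Path3 G a b c = Adj G a b × Adj G b c × NonAdj G a c × a ≢ c

data Part : Set where
  pS pX0 pX pY pY* : Part

Color : Set
Color = Fin 4

-- A list is a subset of {1,2,3,4} (encoded as Fin 4).
ColorList : Set
ColorList = Subset 4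

module _ {n : ℕ} (G : Graph n) (part : Fin n → Part) (f : Fin n → Color) where

  isPart : Part → VSet n
  isPart pS  v with part v
  ... | pS = true
  ... | _  = false
  isPart pX0 v with part v
  ... | pX0 = true
  ... | _   = false
  isPart pX  v with part v
  ... | pX = true
  ... | _  = false
  isPart pY  v with part v
  ... | pY = true
  ... | _  = false
  isPart pY* v with part v
  ... | pY* = true
  ... | _   = false

  Sset Yset Y*set : VSet n
  Sset  = isPart pS
  Yset  = isPart pY
  Y*set = isPart pY*

  usedColors : Fin n → ColorList
  usedColors v = tabulate λ c →
    any (λ s → isPart pS s ∧ adj G v s ∧ does (f s Data.Fin.≟ c)) (allFin n)

  LP : Fin n → ColorList
  LP v = ∁ (usedColors v)

  record StarredPrecoloring : Set where
    field
      properA : ∀ u v → (part u ≡ pS ⊎ part u ≡ pX0) → (part v ≡ pS ⊎ part v ≡ pX0) →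
                Adj G u v → f u ≢ f v
      connC   : Connected G Sset
      notCompleteC : ∀ v → part v ≢ pS → ∃[ s ] (part s ≡ pS × NonAdj G v s)
      nbrD    : ∀ y → part y ≡ pY → ∃[ s ] (part s ≡ pS × Adj G y s)
      colorsE : ∀ x → part x ≡ pX → ∣ usedColors x ∣ ≥ 2
      anticF  : ∀ y z → part y ≡ pY → part z ≡ pY* → NonAdj G y z
      notMixedG : ∀ D → IsComponent G Y*set D → ∀ x → part x ≡ pX → ¬ Mixed G x D
      completeH : ∀ D → IsComponent G Y*set D →
                  ∃[ v ] ((part v ≡ pS ⊎ part v ≡ pX0 ⊎ part v ≡ pX) × Complete G v D)

  record Axioms : Set where
    field
      axI   : ∀ y → part y ≡ pY → ∣ LP y ∣ ≡ 3
      axII  : ∀ (L₁ L₂ : ColorList) → ∣ L₁ ∣ ≡ 3 → ∣ L₂ ∣ ≡ 3 → L₁ ≢ L₂ →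
              ¬ (∃[ a ] ∃[ b ] ∃[ c ] (Path3 G a b c × part a ≡ pY × part b ≡ pY × part c ≡ pY ×
                   LP a ≡ L₁ × LP b ≡ L₂ × LP c ≡ L₂))
      axIII : ∀ (L₁ L₂ L₃ : ColorList) → ∣ L₁ ∣ ≡ 3 → ∣ L₂ ∣ ≡ 3 → ∣ L₃ ∣ ≡ 3 →
              L₁ ≢ L₂ → L₁ ≢ L₃ → L₂ ≢ L₃ →
              ¬ (∃[ a ] ∃[ b ] ∃[ c ] (Path3 G a b c × part a ≡ pY × part b ≡ pY × part c ≡ pY ×
                   LP a ≡ L₁ × LP b ≡ L₂ × LP c ≡ L₃))
      axIV  : ∀ (L₁ : ColorList) → ∣ L₁ ∣ ≡ 3 →
              ¬ (∃[ a ] ∃[ b ] ∃[ c ] (Path3 G a b c × part a ≡ pX × part b ≡ pY × part c ≡ pY ×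
                   LP b ≡ L₁ × LP c ≡ L₁))
      axV   : ∀ (L₁ L₂ : ColorList) → ∣ L₁ ∣ ≡ 3 → ∣ L₂ ∣ ≡ 3 →
              ¬ (∃[ a ] ∃[ b ] ∃[ c ] (Path3 G a b c × LP b ≡ L₁ × LP c ≡ L₂ × part a ≡ pX ×
                   LP a ≢ L₁ Data.Fin.Subset.∩ L₂))

module Submission where

-- Since x is mixed on the connected set C, some edge bc of C has x adjacent to b but not
-- to c; axiom (V) gives L(x) = L(b) ∩ L(c) and (IV) gives L(b) ≠ L(c). Say that the edges
-- at q meet in M if every edge pq of G|Y with L(p) ≠ L(q) has L(p) ∩ L(q) = M. Axioms (II)
-- and (III) say that lists alternate along induced paths a-b-c of G|Y with L(a) ≠ L(b),
-- and for 3-subsets of {1,2,3,4} intersecting with a fixed one is injective. From these,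
-- the edges at b meet in L(b) ∩ L(c), and this property spreads along edges to all of C.
-- Walking from any vertex of C to b then keeps its list in {L(b), L(c)}.

open import Defs
open import Data.Fin using (Fin)
open import Data.Fin.Subset using (_∩_)
open import Data.Product using (_×_; ∃-syntax)
open import Data.Sum using (_⊎_)
open import Relation.Binary.PropositionalEquality using (_≡_; _≢_)

import Data.Nat as ℕ
open import Data.Bool using (true; false)
import Data.Bool as Bool
open import Data.Empty using (⊥-elim)
open import Data.Fin.Subset using (Subset; ∣_∣)
open import Data.Fin.Subset.Properties using (∩-comm; anySubset?)
open import Data.Product using (_,_)
open import Data.Sum using (inj₁; inj₂)
import Data.Sum as Sum
open import Data.Vec.Properties using (≡-dec)
open import Function using (_∘_)
open import Relation.Nullary using (Dec; yes; no; _×-dec_)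
open import Relation.Nullary.Decidable using (¬?; from-no)
open import Relation.Binary.PropositionalEquality
  using (refl; trans; cong; module ≡-Reasoning)
import Relation.Binary.PropositionalEquality as ≡

infix 4 _≟ˢ_
_≟ˢ_ : (A B : Subset 4) → Dec (A ≡ B)
_≟ˢ_ = ≡-dec Bool._≟_

∩-cancelʳ-of-size-3 : ∀ {A B C : Subset 4} → ∣ A ∣ ≡ 3 → ∣ B ∣ ≡ 3 → ∣ C ∣ ≡ 3 →
                      B ∩ A ≡ C ∩ A → B ≡ C
∩-cancelʳ-of-size-3 {A} {B} {C} ∣A∣≡3 ∣B∣≡3 ∣C∣≡3 eq with B ≟ˢ C
... | yes B≡C = B≡C
... | no B≢C = ⊥-elim (from-no counterexample? (A , B , C , ∣A∣≡3 , ∣B∣≡3 , ∣C∣≡3 , eq , B≢C))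
  where
  counterexample? : Dec (∃[ A ] ∃[ B ] ∃[ C ]
    (∣ A ∣ ≡ 3 × ∣ B ∣ ≡ 3 × ∣ C ∣ ≡ 3 × B ∩ A ≡ C ∩ A × B ≢ C))
  counterexample? = anySubset? λ A → anySubset? λ B → anySubset? λ C →
    (∣ A ∣ ℕ.≟ 3) ×-dec (∣ B ∣ ℕ.≟ 3) ×-dec (∣ C ∣ ℕ.≟ 3) ×-dec
    ((B ∩ A) ≟ˢ (C ∩ A)) ×-dec ¬? (B ≟ˢ C)

meets-pair-in-∩⇒in-pair : ∀ {A B V W : Subset 4} → ∣ A ∣ ≡ 3 → ∣ B ∣ ≡ 3 → ∣ V ∣ ≡ 3 →
  W ≡ A ⊎ W ≡ B → V ∩ W ≡ A ∩ B → V ≡ A ⊎ V ≡ B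
meets-pair-in-∩⇒in-pair {A} {B} ∣A∣≡3 ∣B∣≡3 ∣V∣≡3 (inj₁ refl) V∩A≡A∩B =
  inj₂ (∩-cancelʳ-of-size-3 ∣A∣≡3 ∣V∣≡3 ∣B∣≡3 (trans V∩A≡A∩B (∩-comm A B)))
meets-pair-in-∩⇒in-pair ∣A∣≡3 ∣B∣≡3 ∣V∣≡3 (inj₂ refl) V∩B≡A∩B =
  inj₁ (∩-cancelʳ-of-size-3 ∣B∣≡3 ∣V∣≡3 ∣A∣≡3 V∩B≡A∩B)

adj-sym : ∀ {n} (G : Graph n) {u v} → Adj G u v → Adj G v u
adj-sym G {u} {v} uv = trans (sym G v u) uv

reach-source : ∀ {n} {G : Graph n} {W u v} → Reach G W u v → u ∈ᵥ W
reach-source (here u∈W) = u∈W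
reach-source (step u∈W _ _) = u∈W

reach-edge-leaving-nbhd : ∀ {n} {G : Graph n} {W u w} x → Reach G W u w →
  Adj G x u → NonAdj G x w →
  ∃[ b ] ∃[ c ] (b ∈ᵥ W × c ∈ᵥ W × Adj G b c × Adj G x b × NonAdj G x c)
reach-edge-leaving-nbhd x (here _) xu xw with trans (≡.sym xu) xw
... | ()
reach-edge-leaving-nbhd {G = G} x (step {u} {v} u∈W uv v⇝w) xu xw with adj G x v in xv
... | true  = reach-edge-leaving-nbhd x v⇝w xv xw
... | false = u , v , u∈W , reach-source v⇝w , uv , xu , xv

mixed-edge : ∀ {n} {G : Graph n} {C : VSet n} {x} → Connected G C → Mixed G x C →
  ∃[ b ] ∃[ c ] (b ∈ᵥ C × c ∈ᵥ C × Adj G b c × Adj G x b × NonAdj G x c)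
mixed-edge conn ((u , u∈C , xu) , (w , w∈C , xw)) =
  reach-edge-leaving-nbhd _ (conn u w u∈C w∈C) xu xw

module ListsOfY {n} (G : Graph n) (part : Fin n → Part) (f : Fin n → Color) where

  ∈Yset⇒pY : ∀ v → v ∈ᵥ Yset G part f → part v ≡ pY
  ∈Yset⇒pY v v∈Y with part v
  ... | pY = refl
  ∈Yset⇒pY v () | pS
  ∈Yset⇒pY v () | pX0
  ∈Yset⇒pY v () | pX
  ∈Yset⇒pY v () | pY*

  private
    L : Fin n → Subset 4
    L = LP G part f

  ≢-from-lists : ∀ {u v} → L u ≢ L v → u ≢ v
  ≢-from-lists Lu≢Lv refl = Lu≢Lv refl

  X-vertex≢Y-vertex : ∀ {u v} → part u ≡ pX → part v ≡ pY → u ≢ v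
  X-vertex≢Y-vertex u∈X v∈Y refl with trans (≡.sym u∈X) v∈Y
  ... | ()

  module _ (ax : Axioms G part f) where
    open Axioms ax

    lists-alternate : ∀ {a b c} → part a ≡ pY → part b ≡ pY → part c ≡ pY →
      Path3 G a b c → L a ≢ L b → L c ≡ L a
    lists-alternate {a} {b} {c} a∈Y b∈Y c∈Y abc La≢Lb with L c ≟ˢ L a | L c ≟ˢ L b
    ... | yes Lc≡La | _ = Lc≡La
    ... | no _ | yes Lc≡Lb = ⊥-elim (axII (L a) (L b) (axI a a∈Y) (axI b b∈Y) La≢Lb
          (a , b , c , abc , a∈Y , b∈Y , c∈Y , refl , refl , Lc≡Lb))
    ... | no Lc≢La | no Lc≢Lb = ⊥-elim (axIII (L a) (L b) (L c)
          (axI a a∈Y) (axI b b∈Y) (axI c c∈Y) La≢Lb (Lc≢La ∘ ≡.sym) (Lc≢Lb ∘ ≡.sym)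
          (a , b , c , abc , a∈Y , b∈Y , c∈Y , refl , refl , refl))

    list-of-X-end : ∀ {a b c} → part a ≡ pX → part b ≡ pY → part c ≡ pY →
      Path3 G a b c → L a ≡ L b ∩ L c
    list-of-X-end {a} {b} {c} a∈X b∈Y c∈Y abc with L a ≟ˢ L b ∩ L c
    ... | yes La≡Lb∩Lc = La≡Lb∩Lc
    ... | no La≢Lb∩Lc = ⊥-elim (axV (L b) (L c) (axI b b∈Y) (axI c c∈Y)
          (a , b , c , abc , refl , refl , a∈X , La≢Lb∩Lc))

    lists-differ-after-X : ∀ {a b c} → part a ≡ pX → part b ≡ pY → part c ≡ pY →
      Path3 G a b c → L b ≢ L c
    lists-differ-after-X {a} {b} {c} a∈X b∈Y c∈Y abc Lb≡Lc =
      axIV (L b) (axI b b∈Y) (a , b , c , abc , a∈X , b∈Y , c∈Y , refl , ≡.sym Lb≡Lc)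

    DiffEdgesMeetIn : Subset 4 → Fin n → Set
    DiffEdgesMeetIn M q = ∀ p → part p ≡ pY → Adj G p q → L p ≢ L q → L p ∩ L q ≡ M

    diffEdgesMeetIn-at-X-edge : ∀ {x b c} → part x ≡ pX → part b ≡ pY → part c ≡ pY →
      Adj G b c → Adj G x b → NonAdj G x c → DiffEdgesMeetIn (L b ∩ L c) b
    diffEdgesMeetIn-at-X-edge {x} {b} {c} x∈X b∈Y c∈Y bc xb xc p p∈Y pb Lp≢Lb
      with L p ≟ˢ L c
    ... | yes Lp≡Lc = trans (cong (_∩ L b) Lp≡Lc) (∩-comm (L c) (L b))
    ... | no Lp≢Lc with adj G p c in pc
    ... | false = ⊥-elim (Lp≢Lc (≡.sym
          (lists-alternate p∈Y b∈Y c∈Y (pb , bc , pc , ≢-from-lists Lp≢Lc) Lp≢Lb)))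
    ... | true with adj G x p in xp
    ... | false = begin
          L p ∩ L b  ≡⟨ ∩-comm (L p) (L b) ⟩
          L b ∩ L p  ≡⟨ ≡.sym (list-of-X-end x∈X b∈Y p∈Y (xb , adj-sym G pb , xp , x≢ p∈Y)) ⟩
          L x        ≡⟨ list-of-X-end x∈X b∈Y c∈Y (xb , bc , xc , x≢ c∈Y) ⟩
          L b ∩ L c  ∎
      where open ≡-Reasoning
            x≢ : ∀ {v} → part v ≡ pY → x ≢ v
            x≢ = X-vertex≢Y-vertex x∈X
    ... | true = ⊥-elim (Lp≢Lb (∩-cancelʳ-of-size-3 (axI c c∈Y) (axI p p∈Y) (axI b b∈Y) (begin
          L p ∩ L c  ≡⟨ ≡.sym (list-of-X-end x∈X p∈Y c∈Y (xp , pc , xc , x≢ c∈Y)) ⟩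
          L x        ≡⟨ list-of-X-end x∈X b∈Y c∈Y (xb , bc , xc , x≢ c∈Y) ⟩
          L b ∩ L c  ∎)))
      where open ≡-Reasoning
            x≢ : ∀ {v} → part v ≡ pY → x ≢ v
            x≢ = X-vertex≢Y-vertex x∈X

    diffEdgesMeetIn-step : ∀ {M q q'} → part q ≡ pY → part q' ≡ pY → Adj G q q' →
      DiffEdgesMeetIn M q' → DiffEdgesMeetIn M q
    diffEdgesMeetIn-step {M} {q} {q'} q∈Y q'∈Y qq' meet' p p∈Y pq Lp≢Lq with L q' ≟ˢ L p
    ... | yes Lq'≡Lp = begin
          L p ∩ L q   ≡⟨ ∩-comm (L p) (L q) ⟩
          L q ∩ L p   ≡⟨ cong (L q ∩_) (≡.sym Lq'≡Lp) ⟩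
          L q ∩ L q'  ≡⟨ meet' q q∈Y qq' (λ Lq≡Lq' → Lp≢Lq (≡.sym (trans Lq≡Lq' Lq'≡Lp))) ⟩
          M           ∎
      where open ≡-Reasoning
    ... | no Lq'≢Lp with adj G p q' in pq'
    ... | false = ⊥-elim (Lq'≢Lp
          (lists-alternate p∈Y q∈Y q'∈Y (pq , qq' , pq' , ≢-from-lists (Lq'≢Lp ∘ ≡.sym)) Lp≢Lq))
    ... | true with L q' ≟ˢ L q
    ... | yes Lq'≡Lq = trans (cong (L p ∩_) (≡.sym Lq'≡Lq)) (meet' p p∈Y pq' (Lq'≢Lp ∘ ≡.sym))
    ... | no Lq'≢Lq = ⊥-elim (Lp≢Lq (∩-cancelʳ-of-size-3 (axI q' q'∈Y) (axI p p∈Y) (axI q q∈Y)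
          (trans (meet' p p∈Y pq' (Lq'≢Lp ∘ ≡.sym))
                 (≡.sym (meet' q q∈Y qq' (Lq'≢Lq ∘ ≡.sym))))))

    module _ {W : VSet n} (W⊆Y : ∀ v → v ∈ᵥ W → part v ≡ pY) where

      diffEdgesMeetIn-along : ∀ {M u v} → Reach G W u v →
        DiffEdgesMeetIn M v → DiffEdgesMeetIn M u
      diffEdgesMeetIn-along (here _) meet = meet
      diffEdgesMeetIn-along (step u∈W uw w⇝v) meet = diffEdgesMeetIn-step (W⊆Y _ u∈W)
        (W⊆Y _ (reach-source w⇝v)) uw (diffEdgesMeetIn-along w⇝v meet)

      two-lists-along : ∀ {b c v} → part b ≡ pY → part c ≡ pY →
        DiffEdgesMeetIn (L b ∩ L c) b → Reach G W v b → L v ≡ L b ⊎ L v ≡ L c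
      two-lists-along b∈Y c∈Y meet (here _) = inj₁ refl
      two-lists-along b∈Y c∈Y meet (step {v} {w} v∈W vw w⇝b) with L v ≟ˢ L w
      ... | yes Lv≡Lw =
          Sum.map (trans Lv≡Lw) (trans Lv≡Lw) (two-lists-along b∈Y c∈Y meet w⇝b)
      ... | no Lv≢Lw = meets-pair-in-∩⇒in-pair (axI _ b∈Y) (axI _ c∈Y) (axI v (W⊆Y v v∈W))
          (two-lists-along b∈Y c∈Y meet w⇝b)
          (diffEdgesMeetIn-along w⇝b meet v (W⊆Y v v∈W) vw Lv≢Lw)

lemma3p11 : ∀ {n} (G : Graph n) (part : Fin n → Part) (f : Fin n → Color) →
    P6Free G → StarredPrecoloring G part f → Axioms G part f →
    ∀ (C : VSet n) → IsComponent G (Yset G part f) C →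
    ∀ (x : Fin n) → part x ≡ pX → Mixed G x C →
    ∃[ L₁ ] ∃[ L₂ ] (L₁ ≢ L₂ ×
      (∀ v → v ∈ᵥ C → LP G part f v ≡ L₁ ⊎ LP G part f v ≡ L₂) ×
      (∃[ v ] (v ∈ᵥ C × LP G part f v ≡ L₁)) ×
      (∃[ v ] (v ∈ᵥ C × LP G part f v ≡ L₂)) ×
      LP G part f x ≡ L₁ ∩ L₂)
lemma3p11 G part f _ _ ax C (C⊆Yset , _ , C-connected , _) x x∈X x-mixed =
  let b , c , b∈C , c∈C , bc , xb , xc = mixed-edge C-connected x-mixed
      b∈Y = C⊆Y b b∈C
      c∈Y = C⊆Y c c∈C
      xbc = xb , bc , xc , X-vertex≢Y-vertex x∈X c∈Y
      meet-at-b = diffEdgesMeetIn-at-X-edge ax x∈X b∈Y c∈Y bc xb xc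
  in LP G part f b , LP G part f c ,
     lists-differ-after-X ax x∈X b∈Y c∈Y xbc ,
     (λ v v∈C → two-lists-along ax C⊆Y b∈Y c∈Y meet-at-b (C-connected v b v∈C b∈C)) ,
     (b , b∈C , refl) , (c , c∈C , refl) ,
     list-of-X-end ax x∈X b∈Y c∈Y xbc
  where
  open ListsOfY G part f
  C⊆Y : ∀ v → v ∈ᵥ C → part v ≡ pY
  C⊆Y v v∈C = ∈Yset⇒pY v (C⊆Yset v v∈C)
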